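{- Let $n\geq 4$ and $k$ be positive integers, let $\pi$ be a function assigning to each size-$n$ multiset $S$ of $[k]$ a permutation $\pi(S)$ of $S$, with maximum distortion at most $3$. Let $K'\subseteq[k]$ and suppose every $(n-1)$-element subset $R\subseteq K'$ is semi-frozen, and fix for each such $R$ a semi-freezing function $h_R$ and wildcard index $w_R$. Let $Q\subset K'$ with $|Q|=n-2$, and let $R,R'$ be $(n-1)$-element sets with $Q\subset R\subseteq K'$, $Q\subset R'\subseteq K'$, such that there exist distinct $q,q'\in Q$ with $h_R(q)\neq h_{R'}(q)$ and $h_R(q')\neq h_{R'}(q')$. Let $r$ be the unique element of $R\setminus Q$ and $r'$ the unique element of $R'\setminus Q$. Then, after possibly interchanging the names of $q$ and $q'$: (1) $h_R(q)=h_{R'}(r')$ and $h_R(r)=h_{R'}(q')$; (2) $h_R(q')=w_{R'}$ and $h_{R'}(q)=w_R$; (3) $h_R(q'')=h_{R'}(q'')$ for every $q''\in Q\setminus\{q,q'\}$.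
   Context: For strings $X$ of length $n$, $X[i]$ denotes the $i$-th character, $i\in[n]$. The maximum distortion of $\pi$ is the maximum Hamming distance $d(\pi(S),\pi(S'))$ over all pairs of size-$n$ multisets $S,S'$ of $[k]$ whose multiset symmetric difference has size $2$. For $R\subseteq[k]$, $\mathcal U_R$ is the family of all sets $S\subseteq[k]$ with $R\subset S$ and $|S|=|R|+1$. An $(n-1)$-element set $R\subset[k]$ is semi-frozen with semi-freezing function $h_R$ and wildcard index $w_R$ if $h_R:R\to[n]$ is one-to-one, $w_R$ is the unique index of $[n]$ not in the image of $h_R$, and for every $r\in R$ and every $S\in\mathcal U_R$, either $\pi(S)[h_R(r)]=r$ or $\pi(S)[w_R]=r$. -}

module Defs where

open import Data.Nat using (ℕ; zero; suc; _+_; _≤_; _∸_; ∣_-_∣)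
open import Data.Bool using (Bool; true; false; if_then_else_)
open import Data.Fin using (Fin)
open import Data.Fin.Properties using (_≟_)
open import Data.Fin.Subset using (Subset; _∈_; _⊂_; ∣_∣)
open import Data.Vec using (Vec; []; _∷_; lookup; map; sum; count; zipWith)
open import Data.Sum using (_⊎_)
open import Data.Product using (_×_)
open import Relation.Binary.PropositionalEquality using (_≡_; _≢_)
open import Relation.Nullary using (yes; no)

-- A multiset of [k] is its vector of multiplicities (canonical representation).
Multiset : ℕ → Set
Multiset k = Vec ℕ k

size : ∀ {k} → Multiset k → ℕ
size = sum

symDiffSize : ∀ {k} → Multiset k → Multiset k → ℕ
symDiffSize S S' = sum (zipWith ∣_-_∣ S S')

Str : ℕ → ℕ → Set
Str k n = Vec (Fin k) n

occ : ∀ {k n} → Fin k → Str k n → ℕ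
occ x X = count (_≟ x) X

IsPermOf : ∀ {k n} → Str k n → Multiset k → Set
IsPermOf {k} X S = (x : Fin k) → occ x X ≡ lookup S x

hamming : ∀ {k n} → Str k n → Str k n → ℕ
hamming [] [] = 0
hamming (a ∷ X) (b ∷ Y) with a ≟ b
... | yes _ = hamming X Y
... | no _ = suc (hamming X Y)

-- Assignment to each size-n multiset of a permutation of it
-- (values on multisets of other sizes are irrelevant).
IsArrangement : ∀ {k} n → (Multiset k → Str k n) → Set
IsArrangement {k} n π = (S : Multiset k) → size S ≡ n → IsPermOf (π S) S

MaxDistortionAtMost : ∀ {k n} → (Multiset k → Str k n) → ℕ → Set
MaxDistortionAtMost {k} {n} π d =
  (S S' : Multiset k) → size S ≡ n → size S' ≡ n → symDiffSize S S' ≡ 2 →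
  hamming (π S) (π S') ≤ d

toMultiset : ∀ {k} → Subset k → Multiset k
toMultiset = map (λ b → if b then 1 else 0)

InU : ∀ {k} → Subset k → Subset k → Set
InU R S = R ⊂ S × ∣ S ∣ ≡ suc ∣ R ∣

IsSemiFreezing : ∀ {k n} → (Multiset k → Str k n) → Subset k → (Fin k → Fin n) → Fin n → Set
IsSemiFreezing {k} {n} π R h w =
  ∣ R ∣ ≡ n ∸ 1
  × ((a b : Fin k) → a ∈ R → b ∈ R → h a ≡ h b → a ≡ b)
  × ((a : Fin k) → a ∈ R → h a ≢ w)
  × ((r : Fin k) → r ∈ R → (S : Subset k) → InU R S →
       (lookup (π (toMultiset S)) (h r) ≡ r) ⊎ (lookup (π (toMultiset S)) w ≡ r))

-- Both semi-freezings can be tested in the single string X = π(R ∪ R'), an arrangement of an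
-- n-element set and hence injective. As h_R(q) ≠ h_R'(q), q cannot be frozen for both sets, so it
-- sits at one of the two wildcards, and q' (for the same reason) at the other. Every remaining
-- letter of Q is then frozen for both sets at the same position, while the frozen position of a
-- wildcard letter can only hold the letter outside that set, which gives (1)-(3).
module Submission where

open import Defs
open import Data.Nat using (ℕ; zero; suc; _≤_; _∸_; z≤n; s≤s)
open import Data.Nat.Properties using (≤-refl; ≤-trans; n≤1+n; 1+n≰n)
open import Data.Fin using (Fin; zero; suc)
open import Data.Fin.Properties using (_≟_)
open import Data.Fin.Subset using (Subset; _∈_; _∉_; _⊆_; _⊂_; ∣_∣; inside; outside; _∪_; ⁅_⁆)
open import Data.Fin.Subset.Properties
  using (⊆-antisym; p⊂q⇒∣p∣<∣q∣; p⊆p∪q; x∈p∪q⁻; x∈p∪q⁺; x∈⁅x⁆; x∈⁅y⁆⇒x≡y; ∪-identityʳ; _∈?_)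
open import Data.Vec using ([]; _∷_; lookup; here; there)
open import Data.Sum using (_⊎_; inj₁; inj₂; [_,_])
open import Data.Product using (_×_; _,_; proj₁)
open import Data.Empty using (⊥-elim)
open import Function using (_∘_; id; flip)
open import Function.Definitions using (Injective)
open import Relation.Nullary using (yes; no)
open import Relation.Binary.PropositionalEquality using (_≡_; _≢_; refl; sym; trans; cong; subst; module ≡-Reasoning)

private
  variable
    k n : ℕ

∣p∪⁅x⁆∣≡1+∣p∣ : ∀ {p : Subset k} {x} → x ∉ p → ∣ p ∪ ⁅ x ⁆ ∣ ≡ suc ∣ p ∣
∣p∪⁅x⁆∣≡1+∣p∣ {p = inside  ∷ p} {zero}  x∉p = ⊥-elim (x∉p here)
∣p∪⁅x⁆∣≡1+∣p∣ {p = outside ∷ p} {zero}  x∉p = cong (suc ∘ ∣_∣) (∪-identityʳ p)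
∣p∪⁅x⁆∣≡1+∣p∣ {p = inside  ∷ p} {suc x} x∉p = cong suc (∣p∪⁅x⁆∣≡1+∣p∣ (x∉p ∘ there))
∣p∪⁅x⁆∣≡1+∣p∣ {p = outside ∷ p} {suc x} x∉p = ∣p∪⁅x⁆∣≡1+∣p∣ (x∉p ∘ there)

y∈p∪⁅x⁆⁻ : ∀ {p : Subset k} {x y} → y ∈ p ∪ ⁅ x ⁆ → y ∈ p ⊎ y ≡ x
y∈p∪⁅x⁆⁻ {p = p} {x} y∈ = [ inj₁ , inj₂ ∘ x∈⁅y⁆⇒x≡y x ] (x∈p∪q⁻ p ⁅ x ⁆ y∈)

p∪⁅x⁆⊆q : ∀ {p q : Subset k} {x} → p ⊆ q → x ∈ q → p ∪ ⁅ x ⁆ ⊆ q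
p∪⁅x⁆⊆q p⊆q x∈q y∈ = [ p⊆q , (λ { refl → x∈q }) ] (y∈p∪⁅x⁆⁻ y∈)

∣q∣≡1+∣p∣⇒q≡p∪⁅x⁆ : ∀ {p q : Subset k} {x} →
  p ⊆ q → ∣ q ∣ ≡ suc ∣ p ∣ → x ∈ q → x ∉ p → q ≡ p ∪ ⁅ x ⁆
∣q∣≡1+∣p∣⇒q≡p∪⁅x⁆ {p = p} {q} {x} p⊆q ∣q∣ x∈q x∉p =
  ⊆-antisym q⊆p∪⁅x⁆ (p∪⁅x⁆⊆q p⊆q x∈q)
  where
  q⊆p∪⁅x⁆ : q ⊆ p ∪ ⁅ x ⁆
  q⊆p∪⁅x⁆ {y} y∈q with y ∈? p ∪ ⁅ x ⁆
  ... | yes y∈ = y∈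
  ... | no y∉ = ⊥-elim (1+n≰n (subst (λ m → suc m ≤ ∣ q ∣) ∣p∪⁅x⁆∣≡∣q∣ p∪⁅x⁆<q))
    where
    p∪⁅x⁆<q = p⊂q⇒∣p∣<∣q∣ (p∪⁅x⁆⊆q p⊆q x∈q , y , y∈q , y∉)
    ∣p∪⁅x⁆∣≡∣q∣ = trans (∣p∪⁅x⁆∣≡1+∣p∣ x∉p) (sym ∣q∣)

size-toMultiset : (S : Subset k) → size (toMultiset S) ≡ ∣ S ∣
size-toMultiset []            = refl
size-toMultiset (inside  ∷ S) = cong suc (size-toMultiset S)
size-toMultiset (outside ∷ S) = size-toMultiset S

lookup-toMultiset≤1 : (S : Subset k) (x : Fin k) → lookup (toMultiset S) x ≤ 1
lookup-toMultiset≤1 (inside  ∷ S) zero    = s≤s z≤n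
lookup-toMultiset≤1 (outside ∷ S) zero    = z≤n
lookup-toMultiset≤1 (_       ∷ S) (suc x) = lookup-toMultiset≤1 S x

1≤lookup-toMultiset⇒∈ : (S : Subset k) (x : Fin k) → 1 ≤ lookup (toMultiset S) x → x ∈ S
1≤lookup-toMultiset⇒∈ (inside  ∷ S) zero    _ = here
1≤lookup-toMultiset⇒∈ (outside ∷ S) zero    ()
1≤lookup-toMultiset⇒∈ (_       ∷ S) (suc x) p = there (1≤lookup-toMultiset⇒∈ S x p)

occ-here : (x : Fin k) (X : Str k n) → occ x (x ∷ X) ≡ suc (occ x X)
occ-here x X with x ≟ x
... | yes _   = refl
... | no x≢x = ⊥-elim (x≢x refl)

occ-there : (x a : Fin k) (X : Str k n) → occ x X ≤ occ x (a ∷ X)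
occ-there x a X with a ≟ x
... | yes _ = n≤1+n _
... | no _  = ≤-refl

1≤occ-lookup : (X : Str k n) (i : Fin n) → 1 ≤ occ (lookup X i) X
1≤occ-lookup (a ∷ X) zero    rewrite occ-here a X = s≤s z≤n
1≤occ-lookup (a ∷ X) (suc i) = ≤-trans (1≤occ-lookup X i) (occ-there (lookup X i) a X)

occ≤1⇒tail-lookup≢ : (a : Fin k) (X : Str k n) (j : Fin n) → occ a (a ∷ X) ≤ 1 → lookup X j ≢ a
occ≤1⇒tail-lookup≢ a X j c Xj≡a = 1+n≰n (≤-trans (s≤s 1≤occ) (subst (_≤ 1) (occ-here a X) c))
  where
  1≤occ : 1 ≤ occ a X
  1≤occ = subst (λ y → 1 ≤ occ y X) Xj≡a (1≤occ-lookup X j)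

occ≤1⇒lookup-unique : ∀ {x : Fin k} (X : Str k n) {i j} →
  occ x X ≤ 1 → lookup X i ≡ x → lookup X j ≡ x → i ≡ j
occ≤1⇒lookup-unique (a ∷ X) {zero}  {zero}  _ _    _    = refl
occ≤1⇒lookup-unique (a ∷ X) {zero}  {suc j} c refl Xj≡a = ⊥-elim (occ≤1⇒tail-lookup≢ a X j c Xj≡a)
occ≤1⇒lookup-unique (a ∷ X) {suc i} {zero}  c Xi≡a refl = ⊥-elim (occ≤1⇒tail-lookup≢ a X i c Xi≡a)
occ≤1⇒lookup-unique (a ∷ X) {suc i} {suc j} c Xi≡x Xj≡x =
  cong suc (occ≤1⇒lookup-unique X (≤-trans (occ-there _ a X) c) Xi≡x Xj≡x)

module _ {X : Str k n} {S : Subset k} (X-perm : IsPermOf X (toMultiset S)) where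

  permOfSet⇒lookup-injective : Injective _≡_ _≡_ (lookup X)
  permOfSet⇒lookup-injective Xi≡Xj =
    occ≤1⇒lookup-unique X (subst (_≤ 1) (sym (X-perm _)) (lookup-toMultiset≤1 S _)) Xi≡Xj refl

  permOfSet⇒lookup∈ : (i : Fin n) → lookup X i ∈ S
  permOfSet⇒lookup∈ i =
    1≤lookup-toMultiset⇒∈ S _ (subst (1 ≤_) (X-perm (lookup X i)) (1≤occ-lookup X i))

record FreezesIn (X : Str k n) (R : Subset k) (h : Fin k → Fin n) (w : Fin n) : Set where
  field
    h-injective    : ∀ {a b} → a ∈ R → b ∈ R → h a ≡ h b → a ≡ b
    h-avoids-w     : ∀ {a} → a ∈ R → h a ≢ w
    frozen-or-wild : ∀ {x} → x ∈ R → lookup X (h x) ≡ x ⊎ lookup X w ≡ x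

open FreezesIn

IsSemiFreezing⇒FreezesIn : ∀ {π : Multiset k → Str k n} {R S h w} →
  IsSemiFreezing π R h w → InU R S → FreezesIn (π (toMultiset S)) R h w
IsSemiFreezing⇒FreezesIn (_ , inj , avoid , closure) R∈U = record
  { h-injective    = inj _ _
  ; h-avoids-w     = avoid _
  ; frozen-or-wild = λ x∈R → closure _ x∈R _ R∈U
  }

Exchange : (h h' : Fin k → Fin n) (w w' : Fin n) (Q : Subset k) (r r' a b : Fin k) → Set
Exchange h h' w w' Q r r' a b =
  (h a ≡ h' r' × h r ≡ h' b) × (h b ≡ w' × h' a ≡ w)
  × (∀ q'' → q'' ∈ Q → q'' ≢ a → q'' ≢ b → h q'' ≡ h' q'')

module _ {X : Str k n} where

  frozen-unless-wild : ∀ {R h w a x} → FreezesIn X R h w →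
    lookup X w ≡ a → x ∈ R → x ≢ a → lookup X (h x) ≡ x
  frozen-unless-wild F Xw≡a x∈R x≢a =
    [ id , (λ Xw≡x → ⊥-elim (x≢a (trans (sym Xw≡x) Xw≡a))) ] (frozen-or-wild F x∈R)

  module _ (X-injective : Injective _≡_ _≡_ (lookup X)) where

    wild-letter-displaced : ∀ {R h w a r'} → FreezesIn X R h w →
      (∀ i → lookup X i ∈ R ⊎ lookup X i ≡ r') →
      lookup X w ≡ a → a ∈ R → lookup X (h a) ≡ r'
    wild-letter-displaced {h = h} {a = a} F entries Xw≡a a∈R with entries (h a)
    ... | inj₂ Xha≡r' = Xha≡r'
    ... | inj₁ Xha∈R with lookup X (h a) ≟ a
    ...   | yes Xha≡a = ⊥-elim (h-avoids-w F a∈R (X-injective (trans Xha≡a (sym Xw≡a))))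
    ...   | no Xha≢a  = ⊥-elim (Xha≢a (h-injective F Xha∈R a∈R
                          (X-injective (frozen-unless-wild F Xw≡a Xha∈R Xha≢a))))

    frozen-at-other-wild : ∀ {R h w w' a b} → FreezesIn X R h w →
      lookup X w ≡ a → lookup X w' ≡ b → b ∈ R → b ≢ a → h b ≡ w'
    frozen-at-other-wild F Xw≡a Xw'≡b b∈R b≢a =
      X-injective (trans (frozen-unless-wild F Xw≡a b∈R b≢a) (sym Xw'≡b))

    module _ {R R' h h' w w'} (F : FreezesIn X R h w) (F' : FreezesIn X R' h' w') where

      frozen-agree : ∀ {a b x} → lookup X w ≡ a → lookup X w' ≡ b →
        x ∈ R → x ∈ R' → x ≢ a → x ≢ b → h x ≡ h' x
      frozen-agree Xw≡a Xw'≡b x∈R x∈R' x≢a x≢b =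
        X-injective (trans (frozen-unless-wild F Xw≡a x∈R x≢a) (sym (frozen-unless-wild F' Xw'≡b x∈R' x≢b)))

      wild-of-other : ∀ {a b} → lookup X w ≡ a → b ∈ R → b ∈ R' → b ≢ a → h b ≢ h' b →
        lookup X w' ≡ b
      wild-of-other Xw≡a b∈R b∈R' b≢a hb≢h'b =
        [ (λ Xh'b≡b → ⊥-elim (hb≢h'b (X-injective (trans (frozen-unless-wild F Xw≡a b∈R b≢a) (sym Xh'b≡b)))))
        , id
        ] (frozen-or-wild F' b∈R')

      wild-frozen-at-new : ∀ {a b r'} → (∀ i → lookup X i ∈ R ⊎ lookup X i ≡ r') →
        r' ∈ R' → r' ∉ R → lookup X w ≡ a → a ∈ R → lookup X w' ≡ b → b ∈ R → h a ≡ h' r'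
      wild-frozen-at-new entries r'∈R' r'∉R Xw≡a a∈R Xw'≡b b∈R =
        X-injective (trans (wild-letter-displaced F entries Xw≡a a∈R)
                           (sym (frozen-unless-wild F' Xw'≡b r'∈R' r'≢b)))
        where
        r'≢b = λ { refl → r'∉R b∈R }

    module _ {R R' h h' w w' r r'} (F : FreezesIn X R h w) (F' : FreezesIn X R' h' w')
      (entries  : ∀ i → lookup X i ∈ R  ⊎ lookup X i ≡ r')
      (entries' : ∀ i → lookup X i ∈ R' ⊎ lookup X i ≡ r)
      (r∈R : r ∈ R) (r∉R' : r ∉ R') (r'∈R' : r' ∈ R') (r'∉R : r' ∉ R)
      {Q : Subset k} (Q⊆R : Q ⊆ R) (Q⊆R' : Q ⊆ R') where

      exchange : ∀ {a b} → a ∈ Q → b ∈ Q → a ≢ b → lookup X w ≡ a → lookup X w' ≡ b →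
        Exchange h h' w w' Q r r' a b
      exchange a∈Q b∈Q a≢b Xw≡a Xw'≡b =
        ( wild-frozen-at-new F F' entries r'∈R' r'∉R Xw≡a (Q⊆R a∈Q) Xw'≡b (Q⊆R b∈Q)
        , sym (wild-frozen-at-new F' F entries' r∈R r∉R' Xw'≡b (Q⊆R' b∈Q) Xw≡a (Q⊆R' a∈Q)))
        , ( frozen-at-other-wild F Xw≡a Xw'≡b (Q⊆R b∈Q) (a≢b ∘ sym)
          , frozen-at-other-wild F' Xw'≡b Xw≡a (Q⊆R' a∈Q) a≢b)
        , λ q'' q''∈Q → frozen-agree F F' Xw≡a Xw'≡b (Q⊆R q''∈Q) (Q⊆R' q''∈Q)

      exchange-dichotomy : ∀ {q q'} → q ∈ Q → q' ∈ Q → q ≢ q' → h q ≢ h' q → h q' ≢ h' q' →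
        Exchange h h' w w' Q r r' q q'
        ⊎ ((h q' ≡ h' r' × h r ≡ h' q) × (h q ≡ w' × h' q' ≡ w)
          × (∀ q'' → q'' ∈ Q → q'' ≢ q → q'' ≢ q' → h q'' ≡ h' q''))
      exchange-dichotomy {q} {q'} q∈Q q'∈Q q≢q' hq≢h'q hq'≢h'q' with frozen-or-wild F (Q⊆R q∈Q)
      ... | inj₂ Xw≡q = inj₁ (exchange q∈Q q'∈Q q≢q' Xw≡q Xw'≡q')
        where
        Xw'≡q' = wild-of-other F F' Xw≡q (Q⊆R q'∈Q) (Q⊆R' q'∈Q) (q≢q' ∘ sym) hq'≢h'q'
      ... | inj₁ Xhq≡q with frozen-or-wild F' (Q⊆R' q∈Q)
      ...   | inj₁ Xh'q≡q = ⊥-elim (hq≢h'q (X-injective (trans Xhq≡q (sym Xh'q≡q))))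
      ...   | inj₂ Xw'≡q
        with exchange q'∈Q q∈Q (q≢q' ∘ sym)
               (wild-of-other F' F Xw'≡q (Q⊆R' q'∈Q) (Q⊆R q'∈Q) (q≢q' ∘ sym) (hq'≢h'q' ∘ sym)) Xw'≡q
      ...   | pairs , wilds , agree = inj₂ (pairs , wilds , λ q'' q''∈Q → flip (agree q'' q''∈Q))

module TwoExtensions {Q R R' : Subset k} {r r' : Fin k}
  (R≡Q∪⁅r⁆ : R ≡ Q ∪ ⁅ r ⁆) (R'≡Q∪⁅r'⁆ : R' ≡ Q ∪ ⁅ r' ⁆) (r∉Q : r ∉ Q) (r'∉Q : r' ∉ Q) (r≢r' : r ≢ r')
  where

  ∈R⁻ : ∀ {x} → x ∈ R → x ∈ Q ⊎ x ≡ r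
  ∈R⁻ {x} = y∈p∪⁅x⁆⁻ ∘ subst (x ∈_) R≡Q∪⁅r⁆

  ∈R'⁻ : ∀ {x} → x ∈ R' → x ∈ Q ⊎ x ≡ r'
  ∈R'⁻ {x} = y∈p∪⁅x⁆⁻ ∘ subst (x ∈_) R'≡Q∪⁅r'⁆

  Q⊆R : Q ⊆ R
  Q⊆R {x} = subst (x ∈_) (sym R≡Q∪⁅r⁆) ∘ p⊆p∪q ⁅ r ⁆

  Q⊆R' : Q ⊆ R'
  Q⊆R' {x} = subst (x ∈_) (sym R'≡Q∪⁅r'⁆) ∘ p⊆p∪q ⁅ r' ⁆

  r'∉R : r' ∉ R
  r'∉R = [ r'∉Q , r≢r' ∘ sym ] ∘ ∈R⁻

  r∉R' : r ∉ R'
  r∉R' = [ r∉Q , r≢r' ] ∘ ∈R'⁻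

  ∣R∣≡∣R'∣ : ∣ R ∣ ≡ ∣ R' ∣
  ∣R∣≡∣R'∣ = begin
    ∣ R ∣          ≡⟨ cong ∣_∣ R≡Q∪⁅r⁆ ⟩
    ∣ Q ∪ ⁅ r ⁆ ∣  ≡⟨ ∣p∪⁅x⁆∣≡1+∣p∣ r∉Q ⟩
    suc ∣ Q ∣      ≡⟨ ∣p∪⁅x⁆∣≡1+∣p∣ r'∉Q ⟨
    ∣ Q ∪ ⁅ r' ⁆ ∣ ≡⟨ cong ∣_∣ R'≡Q∪⁅r'⁆ ⟨
    ∣ R' ∣         ∎
    where open ≡-Reasoning

  S : Subset k
  S = R ∪ ⁅ r' ⁆

  ∈S⁻ : ∀ {x} → x ∈ S → x ∈ R ⊎ x ≡ r'
  ∈S⁻ = y∈p∪⁅x⁆⁻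

  ∈S⇒∈R'⊎≡r : ∀ {x} → x ∈ S → x ∈ R' ⊎ x ≡ r
  ∈S⇒∈R'⊎≡r = [ [ inj₁ ∘ Q⊆R' , inj₂ ] ∘ ∈R⁻ , (λ { refl → inj₁ r'∈R' }) ] ∘ ∈S⁻
    where
    r'∈R' : r' ∈ R'
    r'∈R' = subst (r' ∈_) (sym R'≡Q∪⁅r'⁆) (x∈p∪q⁺ (inj₂ (x∈⁅x⁆ r')))

  r'∈S : r' ∈ S
  r'∈S = x∈p∪q⁺ (inj₂ (x∈⁅x⁆ r'))

  ∣S∣≡1+∣R∣ : ∣ S ∣ ≡ suc ∣ R ∣
  ∣S∣≡1+∣R∣ = ∣p∪⁅x⁆∣≡1+∣p∣ r'∉R

  R∈U : InU R S
  R∈U = (p⊆p∪q ⁅ r' ⁆ , r' , r'∈S , r'∉R) , ∣S∣≡1+∣R∣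

  R'∈U : InU R' S
  R'∈U = (R'⊆S , r , p⊆p∪q ⁅ r' ⁆ r∈R , r∉R') , trans ∣S∣≡1+∣R∣ (cong suc ∣R∣≡∣R'∣)
    where
    r∈R : r ∈ R
    r∈R = subst (r ∈_) (sym R≡Q∪⁅r⁆) (x∈p∪q⁺ (inj₂ (x∈⁅x⁆ r)))
    R'⊆S : R' ⊆ S
    R'⊆S = [ p⊆p∪q ⁅ r' ⁆ ∘ Q⊆R , (λ { refl → r'∈S }) ] ∘ ∈R'⁻

lemma10 : (n k : ℕ) → 4 ≤ n → 1 ≤ k →
    (π : Multiset k → Str k n) → IsArrangement n π → MaxDistortionAtMost π 3 →
    (K' : Subset k) →
    (h : Subset k → Fin k → Fin n) → (w : Subset k → Fin n) →
    ((R : Subset k) → R ⊆ K' → ∣ R ∣ ≡ n ∸ 1 → IsSemiFreezing π R (h R) (w R)) →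
    (Q : Subset k) → Q ⊂ K' → ∣ Q ∣ ≡ n ∸ 2 →
    (R R' : Subset k) → Q ⊂ R → R ⊆ K' → ∣ R ∣ ≡ n ∸ 1 →
    Q ⊂ R' → R' ⊆ K' → ∣ R' ∣ ≡ n ∸ 1 →
    (q q' : Fin k) → q ∈ Q → q' ∈ Q → q ≢ q' →
    h R q ≢ h R' q → h R q' ≢ h R' q' →
    (r r' : Fin k) → r ∈ R → r ∉ Q → r' ∈ R' → r' ∉ Q →
    ((h R q ≡ h R' r' × h R r ≡ h R' q')
      × (h R q' ≡ w R' × h R' q ≡ w R)
      × ((q'' : Fin k) → q'' ∈ Q → q'' ≢ q → q'' ≢ q' → h R q'' ≡ h R' q''))
    ⊎
    ((h R q' ≡ h R' r' × h R r ≡ h R' q)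
      × (h R q ≡ w R' × h R' q' ≡ w R)
      × ((q'' : Fin k) → q'' ∈ Q → q'' ≢ q → q'' ≢ q' → h R q'' ≡ h R' q''))
lemma10 n k (s≤s (s≤s _)) _ π arrangement _ K' h w semi Q _ ∣Q∣ R R' Q⊂R R⊆K' ∣R∣ Q⊂R' R'⊆K' ∣R'∣
        q q' q∈Q q'∈Q q≢q' hRq≢hR'q hRq'≢hR'q' r r' r∈R r∉Q r'∈R' r'∉Q =
  exchange-dichotomy X-injective (freezes R R⊆K' ∣R∣ R∈U) (freezes R' R'⊆K' ∣R'∣ R'∈U)
    (∈S⁻ ∘ X∈S) (∈S⇒∈R'⊎≡r ∘ X∈S) r∈R r∉R' r'∈R' r'∉R Q⊆R Q⊆R' q∈Q q'∈Q q≢q' hRq≢hR'q hRq'≢hR'q'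
  where
  R≡Q∪⁅r⁆ = ∣q∣≡1+∣p∣⇒q≡p∪⁅x⁆ (proj₁ Q⊂R) (trans ∣R∣ (cong suc (sym ∣Q∣))) r∈R r∉Q
  R'≡Q∪⁅r'⁆ = ∣q∣≡1+∣p∣⇒q≡p∪⁅x⁆ (proj₁ Q⊂R') (trans ∣R'∣ (cong suc (sym ∣Q∣))) r'∈R' r'∉Q

  r≢r' : r ≢ r'
  r≢r' refl = hRq≢hR'q (cong (λ T → h T q) (trans R≡Q∪⁅r⁆ (sym R'≡Q∪⁅r'⁆)))

  open TwoExtensions R≡Q∪⁅r⁆ R'≡Q∪⁅r'⁆ r∉Q r'∉Q r≢r'

  X : Str k n
  X = π (toMultiset S)

  X-perm : IsPermOf X (toMultiset S)
  X-perm = arrangement (toMultiset S) (trans (size-toMultiset S) (trans ∣S∣≡1+∣R∣ (cong suc ∣R∣)))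

  X-injective : Injective _≡_ _≡_ (lookup X)
  X-injective = permOfSet⇒lookup-injective {X = X} {S = S} X-perm

  X∈S : ∀ i → lookup X i ∈ S
  X∈S = permOfSet⇒lookup∈ {X = X} {S = S} X-perm

  freezes : ∀ T → T ⊆ K' → ∣ T ∣ ≡ n ∸ 1 → InU T S → FreezesIn X T (h T) (w T)
  freezes T T⊆K' ∣T∣ = IsSemiFreezing⇒FreezesIn {π = π} (semi T T⊆K' ∣T∣)
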